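{- Let $x$ be a positive irrational number with continued fraction expansion $a=[a_0;a_1,a_2,\dots]$. For every integer $k\geq0$, the number of admissible sequences of length $k$ for $[a_0;\dots,a_{k-1}]$ equals $r_k$.
   Context: $a_0\geq0$, $a_i\geq1$ for $i\geq1$. The sequence $(r_i)$ is defined by $r_{ -1}=r_0=1$ and $r_i=a_{i-1}r_{i-1}+r_{i-2}$ for $i>0$ (equivalently $r_i=p_{i-1}+q_{i-1}$ with $p_j/q_j$ the convergents). A sequence of integers $(b_i)_{0\le i<k}$ is admissible for $[a_0;\dots,a_{k-1}]$ if $0\le b_i\le a_i$ for all $i$; if $i>0$ is odd and $b_i=a_i$ then $b_{i-1}=a_{i-1}$; if $i>0$ is even and $b_i=0$ then $b_{i-1}=0$. (For $k=0$ the only sequence is the empty one.) -}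

module Defs where

open import Data.Nat using (ℕ; zero; suc; _+_; _*_; _≤_; _%_)
open import Data.Product using (_×_; _,_; proj₁; proj₂)
open import Data.Fin using (Fin; toℕ)
open import Data.Vec using (Vec; lookup)
open import Relation.Binary.PropositionalEquality using (_≡_)

-- rPair a n = (r_{n-1} , r_n), with r_{-1} = r_0 = 1 and
-- r_i = a_{i-1} r_{i-1} + r_{i-2} for i > 0.
rPair : (ℕ → ℕ) → ℕ → ℕ × ℕ
rPair a zero = 1 , 1
rPair a (suc n) = proj₂ (rPair a n) , a n * proj₂ (rPair a n) + proj₁ (rPair a n)

r : (ℕ → ℕ) → ℕ → ℕ
r a n = proj₂ (rPair a n)

Admissible : (a : ℕ → ℕ) → {k : ℕ} → Vec ℕ k → Set
Admissible a {k} b =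
  ((i : Fin k) → lookup b i ≤ a (toℕ i)) ×
  ((i j : Fin k) → toℕ j ≡ suc (toℕ i) →
     (toℕ j % 2 ≡ 1 → lookup b j ≡ a (toℕ j) → lookup b i ≡ a (toℕ i)) ×
     (toℕ j % 2 ≡ 0 → lookup b j ≡ 0 → lookup b i ≡ 0))

{-# OPTIONS --safe #-}
-- Sort the admissible sequences of length m + 2 by their last entry b_{m+1} ≤ a_{m+1}. Exactly one
-- value of b_{m+1} restricts b_m: a_{m+1} if m + 1 is odd and 0 if it is even, and it forces b_m to be
-- a_m, resp. 0. The other a_{m+1} values extend every admissible sequence of length m + 1, while that
-- value extends exactly the admissible sequences b_0 … b_{m-1} followed by the forced b_m. Appending the
-- forced b_m never breaks admissibility, because a_m ≥ 1 keeps it from restricting b_{m-1} in turn.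
-- So the counts obey r_{m+2} = a_{m+1} r_{m+1} + r_m, which we realise as an explicit bijection.
module Submission where

open import Defs
open import Data.Nat using (ℕ; zero; suc; _≤_; _%_; _*_; _+_; z≤n; s≤s; s≤s⁻¹)
open import Data.Nat.Properties using (_≟_; ≤-refl; <⇒≢; suc-injective; +-comm; *-identityʳ)
open import Data.Fin using (Fin; zero; suc; toℕ; fromℕ; fromℕ<; inject₁; punchIn; punchOut)
open import Data.Fin.Properties
  using (toℕ<n; toℕ-fromℕ; toℕ-fromℕ<; fromℕ<-toℕ; toℕ-inject₁; toℕ-injective; +↔⊎; *↔×;
         punchInᵢ≢i; punchIn-punchOut; punchOut-punchIn; punchOut-cong)
open import Data.Fin.Relation.Unary.Top using (view; ‵fromℕ; ‵inject₁)
open import Data.Vec using (Vec; []; _∷_; lookup; _∷ʳ_; init; last; initLast)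
open import Data.Vec.Properties using (init-∷ʳ; last-∷ʳ)
open import Data.Product using (Σ; _×_; _,_; proj₁; proj₂)
open import Data.Product.Function.NonDependent.Propositional using (_×-↔_; _×-⇔_)
open import Data.Sum using (_⊎_; inj₁; inj₂)
open import Data.Sum.Function.Propositional using (_⊎-↔_)
open import Data.Empty using (⊥-elim-irr)
open import Data.Irrelevant using (Irrelevant; [_])
open import Function.Bundles using (_↔_; _⇔_; mk↔ₛ′; mk⇔; Equivalence)
open import Function.Properties.Inverse using (↔-refl)
import Function.Properties.Equivalence as ⇔
open import Function.Related.Propositional using (module EquationalReasoning)
open import Relation.Binary.Definitions using (DecidableEquality)
open import Relation.Nullary using (yes; no; contradiction)
open import Relation.Nullary.Decidable using (recompute)
open import Relation.Binary.PropositionalEquality using (_≡_; refl; sym; trans; cong; cong₂; subst; subst₂; _≢_)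

Refined : (A : Set) → (A → Set) → Set
Refined A P = Σ A (λ x → Irrelevant (P x))

refined-≡ : ∀ {A : Set} {P : A → Set} {x y : A} {p : Irrelevant (P x)} {q : Irrelevant (P y)} →
            x ≡ y → _≡_ {A = Refined A P} (x , p) (y , q)
refined-≡ refl = refl

Fin-suc↔≤ : ∀ c → Fin (suc c) ↔ Refined ℕ (_≤ c)
Fin-suc↔≤ c = mk↔ₛ′ to from to∘from from∘to
  where
  to : Fin (suc c) → Refined ℕ (_≤ c)
  to i = toℕ i , [ s≤s⁻¹ (toℕ<n i) ]
  from : Refined ℕ (_≤ c) → Fin (suc c)
  from (x , [ x≤c ]) = fromℕ< (s≤s x≤c)
  to∘from : ∀ x → to (from x) ≡ x
  to∘from (x , _) = refined-≡ (toℕ-fromℕ< _)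
  from∘to : ∀ i → from (to i) ≡ i
  from∘to i = fromℕ<-toℕ i _

Fin↔≤-≢ : ∀ {u c} → u ≤ c → Fin c ↔ Refined ℕ (λ x → x ≤ c × x ≢ u)
Fin↔≤-≢ {u} {c} u≤c = mk↔ₛ′ to from to∘from from∘to
  where
  hole : Fin (suc c)
  hole = fromℕ< (s≤s u≤c)
  toℕ-hole : toℕ hole ≡ u
  toℕ-hole = toℕ-fromℕ< (s≤s u≤c)
  to : Fin c → Refined ℕ (λ x → x ≤ c × x ≢ u)
  to i = toℕ (punchIn hole i) ,
         [ (s≤s⁻¹ (toℕ<n (punchIn hole i)) ,
            λ e → punchInᵢ≢i hole i (toℕ-injective (trans e (sym toℕ-hole)))) ]
  from : Refined ℕ (λ x → x ≤ c × x ≢ u) → Fin c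
  from (x , [ h ]) = punchOut {i = hole} {j = fromℕ< (s≤s (proj₁ h))} hole≢x
    where
    hole≢x : hole ≢ fromℕ< (s≤s (proj₁ h))
    hole≢x e = ⊥-elim-irr (proj₂ h (trans (sym (toℕ-fromℕ< _)) (trans (cong toℕ (sym e)) toℕ-hole)))
  to∘from : ∀ x → to (from x) ≡ x
  to∘from (x , _) = refined-≡ (trans (cong toℕ (punchIn-punchOut _)) (toℕ-fromℕ< _))
  from∘to : ∀ i → from (to i) ≡ i
  from∘to i = trans (punchOut-cong hole (fromℕ<-toℕ (punchIn hole i) _)) (punchOut-punchIn hole)

∷ʳ-init-last : ∀ {A : Set} {n} (v : Vec A (suc n)) → v ≡ init v ∷ʳ last v
∷ʳ-init-last v = proj₂ (proj₂ (initLast v))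

module _ {A : Set} (Q : ∀ {n} → Vec A n → Set) where

  Snoc : ℕ → Set
  Snoc n = Refined (Vec A n × A) (λ p → Q (proj₁ p ∷ʳ proj₂ p))

  Refined-snoc↔ : ∀ {n} → Refined (Vec A (suc n)) Q ↔ Snoc n
  Refined-snoc↔ {n} = mk↔ₛ′ to from to∘from from∘to
    where
    to : Refined (Vec A (suc n)) Q → Snoc n
    to (v , [ q ]) = (init v , last v) , [ subst Q (∷ʳ-init-last v) q ]
    from : Snoc n → Refined (Vec A (suc n)) Q
    from ((v , x) , q) = v ∷ʳ x , q
    to∘from : ∀ y → to (from y) ≡ y
    to∘from ((v , x) , _) = refined-≡ (cong₂ _,_ (init-∷ʳ x v) (last-∷ʳ x v))
    from∘to : ∀ y → from (to y) ≡ y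
    from∘to (v , _) = refined-≡ (sym (∷ʳ-init-last v))

  split-on-trigger : (_≟_ : DecidableEquality A) {n : ℕ} (Ok : A → Set) {u w : A} → Ok u →
    (∀ (v : Vec A (suc n)) x → Q (v ∷ʳ x) ⇔ (Q v × Ok x × (x ≡ u → last v ≡ w))) →
    (∀ (v : Vec A n) → Q (v ∷ʳ w) ⇔ Q v) →
    Snoc (suc n) ↔
      ((Refined A (λ x → Ok x × x ≢ u) × Refined (Vec A (suc n)) Q) ⊎ Refined (Vec A n) Q)
  split-on-trigger _≟_ {n} Ok {u} {w} ok-u Q-∷ʳ Q-∷ʳ-forced = mk↔ₛ′ to from to∘from from∘to
    where
    Split : Set
    Split = (Refined A (λ x → Ok x × x ≢ u) × Refined (Vec A (suc n)) Q) ⊎ Refined (Vec A n) Q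
    snoc⁻¹ : ∀ {v x} → Q (v ∷ʳ x) → Q v × Ok x × (x ≡ u → last v ≡ w)
    snoc⁻¹ {v} {x} = Equivalence.to (Q-∷ʳ v x)
    forced-last : ∀ {v x} → .(Q (v ∷ʳ x)) → x ≡ u → last v ≡ w
    forced-last {v} q x≡u = recompute (last v ≟ w) (proj₂ (proj₂ (snoc⁻¹ q)) x≡u)
    to : Snoc (suc n) → Split
    to ((v , x) , [ q ]) with x ≟ u
    ... | no x≢u =
      inj₁ ((x , [ (proj₁ (proj₂ (snoc⁻¹ q)) , x≢u) ]) , (v , [ proj₁ (snoc⁻¹ q) ]))
    ... | yes x≡u =
      inj₂ (init v , [ Equivalence.to (Q-∷ʳ-forced (init v)) (subst Q v≡init∷ʳw (proj₁ (snoc⁻¹ q))) ])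
      where
      v≡init∷ʳw : v ≡ init v ∷ʳ w
      v≡init∷ʳw = trans (∷ʳ-init-last v) (cong (init v ∷ʳ_) (forced-last q x≡u))
    from : Split → Snoc (suc n)
    from (inj₁ ((x , [ h ]) , (v , [ qv ]))) =
      (v , x) , [ Equivalence.from (Q-∷ʳ v x) (qv , proj₁ h , λ x≡u → ⊥-elim-irr (proj₂ h x≡u)) ]
    from (inj₂ (v , [ qv ])) =
      (v ∷ʳ w , u) , [ Equivalence.from (Q-∷ʳ (v ∷ʳ w) u)
                         (Equivalence.from (Q-∷ʳ-forced v) qv , ok-u , λ _ → last-∷ʳ w v) ]
    to∘from : ∀ y → to (from y) ≡ y
    to∘from (inj₁ ((x , [ h ]) , _)) with x ≟ u
    ... | no _ = refl
    ... | yes x≡u = ⊥-elim-irr (proj₂ h x≡u)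
    to∘from (inj₂ (v , _)) with u ≟ u
    ... | no u≢u = contradiction refl u≢u
    ... | yes _ = cong inj₂ (refined-≡ (init-∷ʳ w v))
    from∘to : ∀ y → from (to y) ≡ y
    from∘to ((v , x) , [ q ]) with x ≟ u
    ... | no _ = refl
    ... | yes refl = refined-≡ (cong (_, u) init∷ʳw≡v)
      where
      init∷ʳw≡v : init v ∷ʳ w ≡ v
      init∷ʳw≡v = trans (cong (init v ∷ʳ_) (sym (forced-last q refl)))
                        (sym (∷ʳ-init-last v))

Link : (ℕ → ℕ) → (i j y x : ℕ) → Set
Link a i j y x = (j % 2 ≡ 1 → x ≡ a j → y ≡ a i) × (j % 2 ≡ 0 → x ≡ 0 → y ≡ 0)

%2-alternates : ∀ m → (m % 2 ≡ 0 × suc m % 2 ≡ 1) ⊎ (m % 2 ≡ 1 × suc m % 2 ≡ 0)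
%2-alternates zero = inj₁ (refl , refl)
%2-alternates (suc zero) = inj₂ (refl , refl)
%2-alternates (suc (suc m)) = %2-alternates m

toℕ-inject₁-fromℕ : ∀ m → toℕ (inject₁ (fromℕ m)) ≡ m
toℕ-inject₁-fromℕ m = trans (toℕ-inject₁ (fromℕ m)) (toℕ-fromℕ m)

lookup-∷ʳ-inject₁ : ∀ {A : Set} {n} (v : Vec A n) x (i : Fin n) →
                    lookup (v ∷ʳ x) (inject₁ i) ≡ lookup v i
lookup-∷ʳ-inject₁ (y ∷ v) x zero = refl
lookup-∷ʳ-inject₁ (y ∷ v) x (suc i) = lookup-∷ʳ-inject₁ v x i

lookup-∷ʳ-fromℕ : ∀ {A : Set} {n} (v : Vec A n) x → lookup (v ∷ʳ x) (fromℕ n) ≡ x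
lookup-∷ʳ-fromℕ [] x = refl
lookup-∷ʳ-fromℕ (y ∷ v) x = lookup-∷ʳ-fromℕ v x

lookup-fromℕ : ∀ {A : Set} {n} (v : Vec A (suc n)) → lookup v (fromℕ n) ≡ last v
lookup-fromℕ (x ∷ []) = refl
lookup-fromℕ (x ∷ y ∷ v) = lookup-fromℕ (y ∷ v)

module _ (a : ℕ → ℕ) where

  Link-cong : ∀ {i i′ j j′ y y′ x x′} → i ≡ i′ → j ≡ j′ → y ≡ y′ → x ≡ x′ →
              Link a i j y x → Link a i′ j′ y′ x′
  Link-cong refl refl refl refl l = l

  admissible-reindex : ∀ {k k′} {v : Vec ℕ k} {w : Vec ℕ k′} (f : Fin k → Fin k′) →
    (∀ i → toℕ (f i) ≡ toℕ i) → (∀ i → lookup w (f i) ≡ lookup v i) →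
    Admissible a w → Admissible a v
  admissible-reindex f toℕ-f lookup-f (bounded , linked) =
    (λ i → subst₂ _≤_ (lookup-f i) (cong a (toℕ-f i)) (bounded (f i))) ,
    (λ i j j≡1+i → Link-cong (toℕ-f i) (toℕ-f j) (lookup-f i) (lookup-f j)
      (linked (f i) (f j) (trans (toℕ-f j) (trans j≡1+i (cong suc (sym (toℕ-f i)))))))

  admissible-init : ∀ {n} (v : Vec ℕ n) x → Admissible a (v ∷ʳ x) → Admissible a v
  admissible-init v x =
    admissible-reindex {v = v} {w = v ∷ʳ x} inject₁ toℕ-inject₁ (lookup-∷ʳ-inject₁ v x)

  admissible-[] : Admissible a []
  admissible-[] = (λ ()) , (λ ())

  admissible-[x] : ∀ x → Admissible a (x ∷ []) ⇔ x ≤ a 0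
  admissible-[x] x =
    mk⇔ (λ (bounded , _) → bounded zero) (λ x≤ → (λ { zero → x≤ }) , (λ { zero zero () }))

  Refined-≤↔admissible-[x] : Refined ℕ (_≤ a 0) ↔ Refined (Vec ℕ 1) (Admissible a)
  Refined-≤↔admissible-[x] = mk↔ₛ′ to from to∘from (λ _ → refl)
    where
    to : Refined ℕ (_≤ a 0) → Refined (Vec ℕ 1) (Admissible a)
    to (x , [ x≤ ]) = x ∷ [] , [ Equivalence.from (admissible-[x] x) x≤ ]
    from : Refined (Vec ℕ 1) (Admissible a) → Refined ℕ (_≤ a 0)
    from (x ∷ [] , [ q ]) = x , [ Equivalence.to (admissible-[x] x) q ]
    to∘from : ∀ y → to (from y) ≡ y
    to∘from (x ∷ [] , _) = refl

  admissible-∷ʳ : ∀ {m} (v : Vec ℕ (suc m)) x →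
    Admissible a (v ∷ʳ x) ⇔ (Admissible a v × x ≤ a (suc m) × Link a m (suc m) (last v) x)
  admissible-∷ʳ {m} v x = mk⇔ unsnoc snoc
    where
    lookup-penultimate : lookup (v ∷ʳ x) (inject₁ (fromℕ m)) ≡ last v
    lookup-penultimate = trans (lookup-∷ʳ-inject₁ v x (fromℕ m)) (lookup-fromℕ v)

    unsnoc : Admissible a (v ∷ʳ x) → Admissible a v × x ≤ a (suc m) × Link a m (suc m) (last v) x
    unsnoc q@(bounded , linked) =
      admissible-init v x q ,
      subst₂ _≤_ (lookup-∷ʳ-fromℕ v x) (cong a (toℕ-fromℕ (suc m))) (bounded (fromℕ (suc m))) ,
      Link-cong (toℕ-inject₁-fromℕ m) (toℕ-fromℕ (suc m)) lookup-penultimate (lookup-∷ʳ-fromℕ v x)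
        (linked (inject₁ (fromℕ m)) (fromℕ (suc m))
          (trans (toℕ-fromℕ (suc m)) (cong suc (sym (toℕ-inject₁-fromℕ m)))))

    snoc : Admissible a v × x ≤ a (suc m) × Link a m (suc m) (last v) x → Admissible a (v ∷ʳ x)
    snoc ((bounded , linked) , x≤ , link) = bounded′ , linked′
      where
      bounded′ : ∀ i → lookup (v ∷ʳ x) i ≤ a (toℕ i)
      bounded′ i with view i
      ... | ‵fromℕ = subst₂ _≤_ (sym (lookup-∷ʳ-fromℕ v x)) (cong a (sym (toℕ-fromℕ (suc m)))) x≤
      ... | ‵inject₁ i′ =
        subst₂ _≤_ (sym (lookup-∷ʳ-inject₁ v x i′)) (cong a (sym (toℕ-inject₁ i′))) (bounded i′)
      linked′ : ∀ i j → toℕ j ≡ suc (toℕ i) →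
                Link a (toℕ i) (toℕ j) (lookup (v ∷ʳ x) i) (lookup (v ∷ʳ x) j)
      linked′ i j j≡1+i with view i | view j
      ... | ‵fromℕ | _ = contradiction (trans j≡1+i (cong suc (toℕ-fromℕ (suc m)))) (<⇒≢ (toℕ<n j))
      ... | ‵inject₁ i′ | ‵inject₁ j′ =
        Link-cong (sym (toℕ-inject₁ i′)) (sym (toℕ-inject₁ j′))
          (sym (lookup-∷ʳ-inject₁ v x i′)) (sym (lookup-∷ʳ-inject₁ v x j′))
          (linked i′ j′ (trans (sym (toℕ-inject₁ j′)) (trans j≡1+i (cong suc (toℕ-inject₁ i′)))))
      ... | ‵inject₁ i′ | ‵fromℕ
        with toℕ-injective {i = i′} {j = fromℕ m}
               (trans (sym (toℕ-inject₁ i′))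
                 (suc-injective (trans (sym j≡1+i)
                   (trans (toℕ-fromℕ (suc m)) (cong suc (sym (toℕ-fromℕ m)))))))
      ... | refl =
        Link-cong (sym (toℕ-inject₁-fromℕ m)) (sym (toℕ-fromℕ (suc m)))
          (sym lookup-penultimate) (sym (lookup-∷ʳ-fromℕ v x)) link

  record Forcing (m : ℕ) : Set where
    field
      trigger forced : ℕ
      trigger≤ : trigger ≤ a (suc m)
      Link⇔ : ∀ y x → Link a m (suc m) y x ⇔ (x ≡ trigger → y ≡ forced)
      admissible-∷ʳ-forced : (v : Vec ℕ m) → Admissible a v → Admissible a (v ∷ʳ forced)

  module _ (pos : ∀ i → 1 ≤ a (suc i)) where

    admissible-∷ʳ-top : ∀ {m} → m % 2 ≡ 0 → (v : Vec ℕ m) → Admissible a v → Admissible a (v ∷ʳ a m)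
    admissible-∷ʳ-top {zero} _ [] _ = Equivalence.from (admissible-[x] (a 0)) ≤-refl
    admissible-∷ʳ-top {suc m} m-even v q = Equivalence.from (admissible-∷ʳ v (a (suc m)))
      (q , ≤-refl , (λ m-odd _ → contradiction (trans (sym m-even) m-odd) λ ()) ,
                    (λ _ a≡0 → contradiction (sym a≡0) (<⇒≢ (pos m))))

    admissible-∷ʳ-zero : ∀ {m} → m % 2 ≡ 1 → (v : Vec ℕ m) → Admissible a v → Admissible a (v ∷ʳ 0)
    admissible-∷ʳ-zero {suc m} m-odd v q = Equivalence.from (admissible-∷ʳ v 0)
      (q , z≤n , (λ _ 0≡a → contradiction 0≡a (<⇒≢ (pos m))) ,
                 (λ m-even _ → contradiction (trans (sym m-odd) m-even) λ ()))

    forcing : ∀ m → Forcing m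
    forcing m with %2-alternates m
    ... | inj₁ (m-even , 1+m-odd) = record
      { trigger = a (suc m)
      ; forced = a m
      ; trigger≤ = ≤-refl
      ; Link⇔ = λ y x → mk⇔ (λ link → proj₁ link 1+m-odd)
          (λ forces → (λ _ → forces) , (λ 1+m-even _ → contradiction (trans (sym 1+m-even) 1+m-odd) λ ()))
      ; admissible-∷ʳ-forced = admissible-∷ʳ-top m-even
      }
    ... | inj₂ (m-odd , 1+m-even) = record
      { trigger = 0
      ; forced = 0
      ; trigger≤ = z≤n
      ; Link⇔ = λ y x → mk⇔ (λ link → proj₂ link 1+m-even)
          (λ forces → (λ 1+m-odd _ → contradiction (trans (sym 1+m-even) 1+m-odd) λ ()) , (λ _ → forces))
      ; admissible-∷ʳ-forced = admissible-∷ʳ-zero m-odd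
      }

    count : ∀ k → Fin (r a k) ↔ Refined (Vec ℕ k) (Admissible a)
    count zero =
      mk↔ₛ′ (λ _ → [] , [ admissible-[] ]) (λ _ → zero) (λ { ([] , _) → refl }) (λ { zero → refl })
    count (suc zero) = begin
      Fin (a 0 * 1 + 1)                ≡⟨ cong Fin (trans (+-comm (a 0 * 1) 1) (cong suc (*-identityʳ (a 0)))) ⟩
      Fin (suc (a 0))                  ↔⟨ Fin-suc↔≤ (a 0) ⟩
      Refined ℕ (_≤ a 0)               ↔⟨ Refined-≤↔admissible-[x] ⟩
      Refined (Vec ℕ 1) (Admissible a) ∎
      where open EquationalReasoning
    count (suc (suc m)) = begin
      Fin (a (suc m) * r a (suc m) + r a m)
        ↔⟨ +↔⊎ ⟩
      (Fin (a (suc m) * r a (suc m)) ⊎ Fin (r a m))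
        ↔⟨ *↔× ⊎-↔ ↔-refl ⟩
      ((Fin (a (suc m)) × Fin (r a (suc m))) ⊎ Fin (r a m))
        ↔⟨ (Fin↔≤-≢ trigger≤ ×-↔ count (suc m)) ⊎-↔ count m ⟩
      ((Refined ℕ (λ x → x ≤ a (suc m) × x ≢ trigger) × Refined (Vec ℕ (suc m)) (Admissible a))
        ⊎ Refined (Vec ℕ m) (Admissible a))
        ↔⟨ split-on-trigger (Admissible a) _≟_ (_≤ a (suc m)) trigger≤
             admissible-∷ʳ⇔ admissible-∷ʳ-forced⇔ ⟨
      Snoc (Admissible a) (suc m)
        ↔⟨ Refined-snoc↔ (Admissible a) ⟨
      Refined (Vec ℕ (suc (suc m))) (Admissible a) ∎
      where
      open EquationalReasoning
      open Forcing (forcing m)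
      admissible-∷ʳ⇔ : ∀ (v : Vec ℕ (suc m)) x → Admissible a (v ∷ʳ x) ⇔
                       (Admissible a v × x ≤ a (suc m) × (x ≡ trigger → last v ≡ forced))
      admissible-∷ʳ⇔ v x = ⇔.trans (admissible-∷ʳ v x) (⇔.refl ×-⇔ (⇔.refl ×-⇔ Link⇔ (last v) x))
      admissible-∷ʳ-forced⇔ : ∀ (v : Vec ℕ m) → Admissible a (v ∷ʳ forced) ⇔ Admissible a v
      admissible-∷ʳ-forced⇔ v = mk⇔ (admissible-init v forced) (admissible-∷ʳ-forced v)

lemma4p1 : (a : ℕ → ℕ) → (∀ i → 1 ≤ a (suc i)) → (k : ℕ) →
    Fin (r a k) ↔ Σ (Vec ℕ k) (λ b → Irrelevant (Admissible a b))
lemma4p1 = count
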